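{- Let $\phi$ be a Drinfeld module of rank $r$ with $\phi_t=\theta+A_1\tau+\cdots+A_r\tau^r$, $A_r\ne0$. Let the Newton polygon of $\phi_t(x)$ have vertices $(q^{d_j},-\deg A_{d_j})$, $0\leqslant j\leqslant s$, with $0=d_0<d_1<\cdots<d_s=r$, and for $1\leqslant j\leqslant s$ let $a_j$ be the $y$-intercept of the line containing the edge from $(q^{d_{j-1}},-\deg A_{d_{j-1}})$ to $(q^{d_j},-\deg A_{d_j})$. Then: (1) $a_1=\mu_m$; (2) $a_1>a_2>\cdots>a_s$; (3) $-a_j\geqslant -\dfrac{\deg A_{d_j}-q^{d_j}}{q^{d_j}-1}$ for every $j=1,\dots,s$.
   Context: $\mathbb{K}$ is the completion of an algebraic closure of $k_\infty=\mathbb{F}_q((1/\theta))$, with absolute value normalized by $|\theta|=q$ and $\deg x:=\log_q|x|$ (so $\deg\theta=1$). A Drinfeld module of rank $r$ is given by $\phi_t=\theta+A_1\tau+\cdots+A_r\tau^r\in\mathbb{K}[\tau]$, $A_r\ne0$; put $A_0:=\theta$, and $\phi_t(x)=\theta x+A_1x^q+\cdots+A_rx^{q^r}\in\mathbb{K}[x]$. The Newton polygon of $\phi_t(x)$ is the lower convex hull of the points $(q^i,-\deg A_i)$ for $0\leqslant i\leqslant r$ with $A_i\neq0$. Let $N(\phi)=\{1\leqslant i\leqslant r: A_i\neq0\}$; for $n\in N(\phi)$ set $\mu_n=(\deg A_n-q^n)/(q^n-1)$, and let $m$ be the smallest index in $N(\phi)$ with $\mu_m\geqslant\mu_i$ for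 all $i\in N(\phi)$. -}

module Defs where

open import Data.Nat as ℕ using (ℕ; zero; suc; _^_)
open import Data.Nat.Primality using (Prime)
open import Data.Integer using (+_)
open import Data.Rational using (ℚ; 0ℚ; 1ℚ; _/_; _-_; _+_; _*_; _÷_; -_; _≤_; _<_; _≥_; ≢-nonZero)
open import Data.Rational.Properties using (_≟_)
open import Data.Maybe using (Maybe; just; nothing)
open import Data.Product using (Σ; ∃; ∃-syntax; _×_; _,_)
open import Relation.Nullary using (yes; no)
open import Relation.Binary.PropositionalEquality using (_≡_)

IsPrimePower : ℕ → Set
IsPrimePower q = ∃[ p ] ∃[ k ] (Prime p × 1 ℕ.≤ k × q ≡ p ^ k)

ℕtoℚ : ℕ → ℚ
ℕtoℚ n = (+ n) / 1

qpow : ℕ → ℕ → ℚ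
qpow q n = ℕtoℚ (q ^ n)

-- division, totalised by x ÷ 0 := 0 (only ever used with nonzero divisors)
_÷'_ : ℚ → ℚ → ℚ
x ÷' y with y ≟ 0ℚ
... | yes _ = 0ℚ
... | no y≢0 = _÷_ x y {{≢-nonZero y≢0}}

-- μ_n = (deg A_n - q^n) / (q^n - 1), with v = deg A_n
μ : ℕ → ℕ → ℚ → ℚ
μ q n v = (v - qpow q n) ÷' (qpow q n - 1ℚ)

-- Coefficient data of φ_t = θ + A_1 τ + ... + A_r τ^r:
-- degA i = just (deg A_i) if A_i ≠ 0, and nothing if A_i = 0.

slope : ℚ → ℚ → ℚ → ℚ → ℚ
slope x₁ y₁ x₂ y₂ = (y₂ - y₁) ÷' (x₂ - x₁)

yIntercept : ℚ → ℚ → ℚ → ℚ → ℚ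
yIntercept x₁ y₁ x₂ y₂ = y₁ - slope x₁ y₁ x₂ y₂ * x₁

OnOrAbove : ℚ → ℚ → ℚ → ℚ → ℚ → ℚ → Set
OnOrAbove x₁ y₁ x₂ y₂ x y = y₁ + slope x₁ y₁ x₂ y₂ * (x - x₁) ≤ y

-- The Newton polygon of φ_t(x) (lower convex hull of the points
-- (q^i, -deg A_i), 0 ≤ i ≤ r, A_i ≠ 0) has vertices (q^{d j}, -e j),
-- 0 ≤ j ≤ s, where e j = deg A_{d j}.  Characterisation: the d j are
-- indices of nonzero coefficients, 0 = d 0 < d 1 < ... < d s = r, the
-- slopes of consecutive edges strictly increase (so each d j is a genuine
-- corner), and every point lies on or above the line of every edge.
record NewtonVertices (q r : ℕ) (degA : ℕ → Maybe ℚ)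
                      (s : ℕ) (d : ℕ → ℕ) (e : ℕ → ℚ) : Set where
  field
    start   : d 0 ≡ 0
    end     : d s ≡ r
    incr    : ∀ j → j ℕ.< s → d j ℕ.< d (suc j)
    isPoint : ∀ j → j ℕ.≤ s → degA (d j) ≡ just (e j)
    convex  : ∀ j → suc j ℕ.< s →
      slope (qpow q (d j)) (- e j) (qpow q (d (suc j))) (- e (suc j))
        < slope (qpow q (d (suc j))) (- e (suc j))
                (qpow q (d (suc (suc j)))) (- e (suc (suc j)))
    lower   : ∀ j → j ℕ.< s → ∀ i v → i ℕ.≤ r → degA i ≡ just v →
      OnOrAbove (qpow q (d j)) (- e j) (qpow q (d (suc j))) (- e (suc j))
                (qpow q i) (- v)

edgeIntercept : (q : ℕ) (d : ℕ → ℕ) (e : ℕ → ℚ) → ℕ → ℚ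
edgeIntercept q d e zero = 0ℚ   -- unused (edges are numbered from 1)
edgeIntercept q d e (suc j) =
  yIntercept (qpow q (d j)) (- e j) (qpow q (d (suc j))) (- e (suc j))

IsM : (q r : ℕ) (degA : ℕ → Maybe ℚ) (m : ℕ) (vm : ℚ) → Set
IsM q r degA m vm =
  (1 ℕ.≤ m × m ℕ.≤ r × degA m ≡ just vm)
  × (∀ i v → 1 ℕ.≤ i → i ℕ.≤ r → degA i ≡ just v → μ q i v ≤ μ q m vm)
  × (∀ i v → 1 ℕ.≤ i → i ℕ.< m → degA i ≡ just v → μ q i v < μ q m vm)

module Submission where

-- Read every line as y = a + σx, so that its y-intercept is its value at 0.  The
-- chord from the first Newton point (q⁰, -deg θ) = (1, -1) to (qⁿ, -v) has
-- intercept exactly μ_n.  To the left of the abscissa where two lines cross, the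
-- line of smaller slope lies above.
-- (2): consecutive edges cross at a vertex of positive abscissa, and their slopes
-- increase.  (3): the j-th edge crosses the chord to its right end there and lies
-- below (1, -1), so it has the larger slope.  (1): the first edge is the chord to
-- the vertex d₁, so a₁ = μ_{d₁} ≤ μ_m; it lies below (q^m, -deg A_m), so its slope
-- is at most that of the chord to that point, whence μ_m ≤ a₁.

open import Defs
open import Data.Nat as ℕ using (ℕ; suc)
open import Data.Rational using (ℚ; 1ℚ; -_; _<_; _>_; _≥_)
open import Data.Maybe using (Maybe; just)
open import Data.Product using (∃-syntax; _×_)
open import Relation.Binary.PropositionalEquality using (_≡_)

import Data.Nat.Properties as ℕ
import Data.Integer as ℤ
import Data.Integer.Properties as ℤ
import Data.Nat.Coprimality as Coprime
open import Data.Nat.Primality using (prime⇒nonTrivial)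
open import Data.Rational
  using (0ℚ; mkℚ; _+_; _*_; _-_; 1/_; _≤_; *<*; ≢-nonZero; positive; negative; nonPositive)
open import Data.Rational.Properties
open import Data.Maybe.Properties using (just-injective)
open import Data.Product using (_,_)
open import Data.Sum using (inj₁; inj₂)
open import Data.List using (_∷_; [])
open import Function using (_∘_)
open import Relation.Binary.PropositionalEquality
  using (_≢_; refl; sym; trans; cong; cong₂; subst; subst₂; module ≡-Reasoning)
open import Relation.Nullary using (yes; no; contradiction)
open import Relation.Nullary.Decidable using (dec⇒maybe)
open import Tactic.RingSolver using (solve; solve-∀)
open import Tactic.RingSolver.Core.AlmostCommutativeRing
  using (AlmostCommutativeRing; fromCommutativeRing)

ℚ-ring : AlmostCommutativeRing _ _
ℚ-ring = fromCommutativeRing +-*-commutativeRing (λ x → dec⇒maybe (0ℚ ≟ x))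

p<q⇒0<q-p : ∀ {p q} → p < q → 0ℚ < q - p
p<q⇒0<q-p {p} {q} p<q = subst (_< q - p) (+-inverseʳ p) (+-monoˡ-< (- p) p<q)

p<q⇒p-q<0 : ∀ {p q} → p < q → p - q < 0ℚ
p<q⇒p-q<0 {p} {q} p<q = subst (p - q <_) (+-inverseʳ q) (+-monoˡ-< (- q) p<q)

p≤q⇒p-q≤0 : ∀ {p q} → p ≤ q → p - q ≤ 0ℚ
p≤q⇒p-q≤0 {p} {q} p≤q = subst (p - q ≤_) (+-inverseʳ q) (+-monoˡ-≤ (- q) p≤q)

+-cancelˡ-≤ : ∀ r {p q} → r + p ≤ r + q → p ≤ q
+-cancelˡ-≤ r {p} {q} = subst₂ _≤_ (-r+[r+x]≡x p) (-r+[r+x]≡x q) ∘ +-monoʳ-≤ (- r)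
  where
  -r+[r+x]≡x : ∀ x → - r + (r + x) ≡ x
  -r+[r+x]≡x x = solve (r ∷ x ∷ []) ℚ-ring

x÷'y*y≡x : ∀ x {y} → y ≢ 0ℚ → (x ÷' y) * y ≡ x
x÷'y*y≡x x {y} y≢0 with y ≟ 0ℚ
... | yes y≡0 = contradiction y≡0 y≢0
... | no  y≢0′ = begin
  x * 1/ y * y     ≡⟨ *-assoc x (1/ y) y ⟩
  x * (1/ y * y)   ≡⟨ cong (x *_) (*-inverseˡ y) ⟩
  x * 1ℚ           ≡⟨ *-identityʳ x ⟩
  x                ∎
  where
  open ≡-Reasoning
  instance _ = ≢-nonZero y≢0′

x*y÷'y≡x : ∀ x {y} → y ≢ 0ℚ → (x * y) ÷' y ≡ x
x*y÷'y≡x x {y} y≢0 with y ≟ 0ℚ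
... | yes y≡0 = contradiction y≡0 y≢0
... | no  y≢0′ = begin
  x * y * 1/ y     ≡⟨ *-assoc x y (1/ y) ⟩
  x * (y * 1/ y)   ≡⟨ cong (x *_) (*-inverseʳ y) ⟩
  x * 1ℚ           ≡⟨ *-identityʳ x ⟩
  x                ∎
  where
  open ≡-Reasoning
  instance _ = ≢-nonZero y≢0′

ℕtoℚ≡mkℚ : ∀ n → ℕtoℚ n ≡ mkℚ (ℤ.+ n) 0 (Coprime.sym (Coprime.1-coprimeTo n))
ℕtoℚ≡mkℚ n = normalize-coprime (Coprime.sym (Coprime.1-coprimeTo n))

ℕtoℚ-mono-< : ∀ {m n} → m ℕ.< n → ℕtoℚ m < ℕtoℚ n
ℕtoℚ-mono-< {m} {n} m<n rewrite ℕtoℚ≡mkℚ m | ℕtoℚ≡mkℚ n =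
  *<* (subst₂ ℤ._<_ (sym (ℤ.*-identityʳ (ℤ.+ m))) (sym (ℤ.*-identityʳ (ℤ.+ n))) (ℤ.+<+ m<n))

primePower>1 : ∀ {q} → IsPrimePower q → 1 ℕ.< q
primePower>1 (p , k , p-prime , 1≤k , refl) =
  ℕ.^-monoʳ-< p (ℕ.nonTrivial⇒n>1 p {{prime⇒nonTrivial p-prime}}) 1≤k

record Line : Set where
  constructor line
  field
    intercept gradient : ℚ

open Line

infix 8 _⟨_⟩

through : ℚ → ℚ → ℚ → ℚ → Line
through x₁ y₁ x₂ y₂ = line (yIntercept x₁ y₁ x₂ y₂) (slope x₁ y₁ x₂ y₂)

-- Opaque so that unification matches `ℓ ⟨ x ⟩` itself rather than the
-- division hidden in `through`.
opaque
  _⟨_⟩ : Line → ℚ → ℚ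
  ℓ ⟨ x ⟩ = intercept ℓ + gradient ℓ * x

  ⟨⟩-definition : ∀ ℓ x → ℓ ⟨ x ⟩ ≡ intercept ℓ + gradient ℓ * x
  ⟨⟩-definition ℓ x = refl

  ⟨0⟩≡intercept : ∀ ℓ → ℓ ⟨ 0ℚ ⟩ ≡ intercept ℓ
  ⟨0⟩≡intercept (line a σ) = trans (cong (a +_) (*-zeroʳ σ)) (+-identityʳ a)

  ⟨⟩-shift : ∀ ℓ u w → ℓ ⟨ w ⟩ ≡ ℓ ⟨ u ⟩ + gradient ℓ * (w - u)
  ⟨⟩-shift (line a σ) u w = shift
    where
    shift : a + σ * w ≡ (a + σ * u) + σ * (w - u)
    shift = solve (a ∷ σ ∷ u ∷ w ∷ []) ℚ-ring

  through-⟨x₁⟩ : ∀ x₁ y₁ x₂ y₂ → through x₁ y₁ x₂ y₂ ⟨ x₁ ⟩ ≡ y₁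
  through-⟨x₁⟩ x₁ y₁ x₂ y₂ = passes (slope x₁ y₁ x₂ y₂)
    where
    passes : ∀ σ → (y₁ - σ * x₁) + σ * x₁ ≡ y₁
    passes σ = solve (x₁ ∷ y₁ ∷ σ ∷ []) ℚ-ring

  onOrAbove⇒⟨⟩≤ : ∀ x₁ y₁ x₂ y₂ {x y} → OnOrAbove x₁ y₁ x₂ y₂ x y → through x₁ y₁ x₂ y₂ ⟨ x ⟩ ≤ y
  onOrAbove⇒⟨⟩≤ x₁ y₁ x₂ y₂ {x} = subst (_≤ _) (recentre (slope x₁ y₁ x₂ y₂))
    where
    recentre : ∀ σ → y₁ + σ * (x - x₁) ≡ (y₁ - σ * x₁) + σ * x
    recentre σ = solve (x₁ ∷ y₁ ∷ x ∷ σ ∷ []) ℚ-ring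

through-⟨x₂⟩ : ∀ x₁ y₁ x₂ y₂ → x₂ - x₁ ≢ 0ℚ → through x₁ y₁ x₂ y₂ ⟨ x₂ ⟩ ≡ y₂
through-⟨x₂⟩ x₁ y₁ x₂ y₂ Δx≢0 = begin
  through x₁ y₁ x₂ y₂ ⟨ x₂ ⟩  ≡⟨ ⟨⟩-shift (through x₁ y₁ x₂ y₂) x₁ x₂ ⟩
  through x₁ y₁ x₂ y₂ ⟨ x₁ ⟩ + σ * (x₂ - x₁)
                              ≡⟨ cong₂ _+_ (through-⟨x₁⟩ x₁ y₁ x₂ y₂) (x÷'y*y≡x (y₂ - y₁) Δx≢0) ⟩
  y₁ + (y₂ - y₁)              ≡⟨ solve (y₁ ∷ y₂ ∷ []) ℚ-ring ⟩
  y₂                          ∎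
  where
  open ≡-Reasoning
  σ = slope x₁ y₁ x₂ y₂

module _ {ℓ ℓ′ : Line} {u : ℚ} (cross : ℓ ⟨ u ⟩ ≡ ℓ′ ⟨ u ⟩) where

  private
    ⟨⟩-shift′ : ∀ w → ℓ′ ⟨ w ⟩ ≡ ℓ ⟨ u ⟩ + gradient ℓ′ * (w - u)
    ⟨⟩-shift′ w = trans (⟨⟩-shift ℓ′ u w) (cong (_+ gradient ℓ′ * (w - u)) (sym cross))

    ≤⇒gradient*Δ-≤ : ∀ w → ℓ ⟨ w ⟩ ≤ ℓ′ ⟨ w ⟩ → gradient ℓ * (w - u) ≤ gradient ℓ′ * (w - u)
    ≤⇒gradient*Δ-≤ w = +-cancelˡ-≤ (ℓ ⟨ u ⟩) ∘ subst₂ _≤_ (⟨⟩-shift ℓ u w) (⟨⟩-shift′ w)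

  ≤-right⇒gradient-≤ : ∀ {w} → u < w → ℓ ⟨ w ⟩ ≤ ℓ′ ⟨ w ⟩ → gradient ℓ ≤ gradient ℓ′
  ≤-right⇒gradient-≤ {w} u<w =
    *-cancelʳ-≤-pos (w - u) {{positive (p<q⇒0<q-p u<w)}} ∘ ≤⇒gradient*Δ-≤ w

  ≤-left⇒gradient-≥ : ∀ {w} → w < u → ℓ ⟨ w ⟩ ≤ ℓ′ ⟨ w ⟩ → gradient ℓ′ ≤ gradient ℓ
  ≤-left⇒gradient-≥ {w} w<u =
    *-cancelʳ-≤-neg (w - u) {{negative (p<q⇒p-q<0 w<u)}} ∘ ≤⇒gradient*Δ-≤ w

  gradient-≤⇒≥-left : ∀ {w} → w ≤ u → gradient ℓ ≤ gradient ℓ′ → ℓ′ ⟨ w ⟩ ≤ ℓ ⟨ w ⟩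
  gradient-≤⇒≥-left {w} w≤u σ≤σ′ = subst₂ _≤_ (sym (⟨⟩-shift′ w)) (sym (⟨⟩-shift ℓ u w))
    (+-monoʳ-≤ (ℓ ⟨ u ⟩) (*-monoʳ-≤-nonPos (w - u) {{nonPositive (p≤q⇒p-q≤0 w≤u)}} σ≤σ′))

  gradient-<⇒>-left : ∀ {w} → w < u → gradient ℓ < gradient ℓ′ → ℓ′ ⟨ w ⟩ < ℓ ⟨ w ⟩
  gradient-<⇒>-left {w} w<u σ<σ′ = subst₂ _<_ (sym (⟨⟩-shift′ w)) (sym (⟨⟩-shift ℓ u w))
    (+-monoʳ-< (ℓ ⟨ u ⟩) (*-monoˡ-<-neg (w - u) {{negative (p<q⇒p-q<0 w<u)}} σ<σ′))

chord : ℕ → ℕ → ℚ → Line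
chord q n v = through 1ℚ (- 1ℚ) (qpow q n) (- v)

module _ {q : ℕ} (1<q : 1 ℕ.< q) where

  qpow-mono-< : ∀ {m n} → m ℕ.< n → qpow q m < qpow q n
  qpow-mono-< = ℕtoℚ-mono-< ∘ ℕ.^-monoʳ-< q 1<q

  qpow-positive : ∀ n → 0ℚ < qpow q n
  qpow-positive n = ℕtoℚ-mono-< (ℕ.m^n>0 q n)
    where instance _ = ℕ.>-nonZero (ℕ.<⇒≤ 1<q)

  1<qpow : ∀ {n} → 1 ℕ.≤ n → 1ℚ < qpow q n
  1<qpow = qpow-mono-< {0}

  qpow-1≢0 : ∀ {n} → 1 ℕ.≤ n → qpow q n - 1ℚ ≢ 0ℚ
  qpow-1≢0 1≤n eq = <-irrefl (sym eq) (p<q⇒0<q-p (1<qpow 1≤n))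

  chord-⟨1⟩ : ∀ n v → chord q n v ⟨ 1ℚ ⟩ ≡ - 1ℚ
  chord-⟨1⟩ n v = through-⟨x₁⟩ 1ℚ (- 1ℚ) (qpow q n) (- v)

  chord-⟨qⁿ⟩ : ∀ {n} v → 1 ℕ.≤ n → chord q n v ⟨ qpow q n ⟩ ≡ - v
  chord-⟨qⁿ⟩ {n} v 1≤n = through-⟨x₂⟩ 1ℚ (- 1ℚ) (qpow q n) (- v) (qpow-1≢0 1≤n)

  μ≡intercept-chord : ∀ {n} v → 1 ℕ.≤ n → μ q n v ≡ intercept (chord q n v)
  μ≡intercept-chord {n} v 1≤n = begin
    (v - Q) ÷' (Q - 1ℚ)      ≡⟨ cong (_÷' (Q - 1ℚ)) numerator ⟩
    (a * (Q - 1ℚ)) ÷' (Q - 1ℚ) ≡⟨ x*y÷'y≡x a (qpow-1≢0 1≤n) ⟩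
    a                        ∎
    where
    open ≡-Reasoning
    Q = qpow q n
    ℓ = chord q n v
    a = intercept ℓ
    σ = gradient ℓ
    numerator : v - Q ≡ a * (Q - 1ℚ)
    numerator = begin
      v - Q                   ≡⟨ rearrange v Q ⟩
      (- 1ℚ) * Q - (- v)      ≡⟨ cong₂ (λ y₁ y₂ → y₁ * Q - y₂) (sym (chord-⟨1⟩ n v)) (sym (chord-⟨qⁿ⟩ v 1≤n)) ⟩
      ℓ ⟨ 1ℚ ⟩ * Q - ℓ ⟨ Q ⟩  ≡⟨ cong₂ (λ y₁ y₂ → y₁ * Q - y₂) (⟨⟩-definition ℓ 1ℚ) (⟨⟩-definition ℓ Q) ⟩
      (a + σ * 1ℚ) * Q - (a + σ * Q)
                              ≡⟨ eliminate-gradient a σ Q ⟩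
      a * (Q - 1ℚ)            ∎
      where
      rearrange : ∀ v Q → v - Q ≡ (- 1ℚ) * Q - (- v)
      rearrange = solve-∀ ℚ-ring
      eliminate-gradient : ∀ a σ Q → (a + σ * 1ℚ) * Q - (a + σ * Q) ≡ a * (Q - 1ℚ)
      eliminate-gradient = solve-∀ ℚ-ring

stepwise-<⇒mono-≤ : ∀ {s} (f : ℕ → ℕ) → (∀ j → j ℕ.< s → f j ℕ.< f (suc j)) →
                    ∀ {j k} → j ℕ.≤ k → k ℕ.≤ s → f j ℕ.≤ f k
stepwise-<⇒mono-≤ f step {k = ℕ.zero} ℕ.z≤n _ = ℕ.≤-refl
stepwise-<⇒mono-≤ f step {j} {suc k} j≤1+k 1+k≤s with ℕ.m≤n⇒m<n∨m≡n j≤1+k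
... | inj₂ refl          = ℕ.≤-refl
... | inj₁ (ℕ.s≤s j≤k) =
  ℕ.≤-trans (stepwise-<⇒mono-≤ f step j≤k (ℕ.<⇒≤ 1+k≤s)) (ℕ.<⇒≤ (step k 1+k≤s))

module NewtonPolygon {q r : ℕ} (1<q : 1 ℕ.< q) {degA : ℕ → Maybe ℚ}
                     {s : ℕ} {d : ℕ → ℕ} {e : ℕ → ℚ}
                     (nv : NewtonVertices q r degA s d e) where

  open NewtonVertices nv

  X : ℕ → ℚ
  X j = qpow q (d j)

  edge : ℕ → Line
  edge j = through (X j) (- e j) (X (suc j)) (- e (suc j))

  edge-⟨left⟩ : ∀ j → edge j ⟨ X j ⟩ ≡ - e j
  edge-⟨left⟩ j = through-⟨x₁⟩ (X j) (- e j) (X (suc j)) (- e (suc j))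

  edge-⟨right⟩ : ∀ {j} → j ℕ.< s → edge j ⟨ X (suc j) ⟩ ≡ - e (suc j)
  edge-⟨right⟩ {j} j<s = through-⟨x₂⟩ (X j) (- e j) (X (suc j)) (- e (suc j)) Δx≢0
    where
    Δx≢0 : X (suc j) - X j ≢ 0ℚ
    Δx≢0 eq = <-irrefl (sym eq) (p<q⇒0<q-p (qpow-mono-< 1<q (incr j j<s)))

  edge-⟨⟩≤ : ∀ {j i v} → j ℕ.< s → i ℕ.≤ r → degA i ≡ just v → edge j ⟨ qpow q i ⟩ ≤ - v
  edge-⟨⟩≤ {j} {i} {v} j<s i≤r Aᵢ =
    onOrAbove⇒⟨⟩≤ (X j) (- e j) (X (suc j)) (- e (suc j)) (lower j j<s i v i≤r Aᵢ)

  s>0 : 1 ℕ.≤ r → 0 ℕ.< s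
  s>0 1≤r = ℕ.n≢0⇒n>0 λ s≡0 → ℕ.<⇒≢ 1≤r (sym (trans (sym end) (trans (cong d s≡0) start)))

  1≤d[1+j] : ∀ {j} → j ℕ.< s → 1 ℕ.≤ d (suc j)
  1≤d[1+j] {j} j<s = ℕ.≤-trans (ℕ.s≤s ℕ.z≤n) (incr j j<s)

  intercept-edge-decreasing : ∀ {j} → suc j ℕ.< s → intercept (edge (suc j)) < intercept (edge j)
  intercept-edge-decreasing {j} 1+j<s = subst₂ _<_ (⟨0⟩≡intercept _) (⟨0⟩≡intercept _)
    (gradient-<⇒>-left cross (qpow-positive 1<q (d (suc j))) (convex j 1+j<s))
    where
    cross : edge j ⟨ X (suc j) ⟩ ≡ edge (suc j) ⟨ X (suc j) ⟩
    cross = trans (edge-⟨right⟩ (ℕ.<-trans (ℕ.n<1+n j) 1+j<s)) (sym (edge-⟨left⟩ (suc j)))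

  module _ (A₀ : degA 0 ≡ just 1ℚ) where

    intercept-edge≤μ : ∀ {j} → j ℕ.< s → intercept (edge j) ≤ μ q (d (suc j)) (e (suc j))
    intercept-edge≤μ {j} j<s = subst₂ _≤_ (⟨0⟩≡intercept _)
      (trans (⟨0⟩≡intercept chordⱼ) (sym (μ≡intercept-chord 1<q (e (suc j)) (1≤d[1+j] j<s))))
      (gradient-≤⇒≥-left (sym cross) (<⇒≤ (qpow-positive 1<q (d (suc j))))
        (≤-left⇒gradient-≥ cross (1<qpow 1<q (1≤d[1+j] j<s)) below-at-1))
      where
      chordⱼ = chord q (d (suc j)) (e (suc j))
      cross : edge j ⟨ X (suc j) ⟩ ≡ chordⱼ ⟨ X (suc j) ⟩
      cross = trans (edge-⟨right⟩ j<s) (sym (chord-⟨qⁿ⟩ 1<q (e (suc j)) (1≤d[1+j] j<s)))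
      below-at-1 : edge j ⟨ 1ℚ ⟩ ≤ chordⱼ ⟨ 1ℚ ⟩
      below-at-1 = subst (edge j ⟨ 1ℚ ⟩ ≤_) (sym (chord-⟨1⟩ 1<q (d (suc j)) (e (suc j))))
                         (edge-⟨⟩≤ j<s ℕ.z≤n A₀)

    e₀≡1 : e 0 ≡ 1ℚ
    e₀≡1 = just-injective (trans (sym A₀′) A₀)
      where
      A₀′ : degA 0 ≡ just (e 0)
      A₀′ = subst (λ i → degA i ≡ just (e 0)) start (isPoint 0 ℕ.z≤n)

    edge₀≡chord : edge 0 ≡ chord q (d 1) (e 1)
    edge₀≡chord = cong₂ (λ x y → through x (- y) (X 1) (- e 1)) (cong (qpow q) start) e₀≡1

    intercept-first-edge : 1 ℕ.≤ r → ∀ {m vm} → IsM q r degA m vm → intercept (edge 0) ≡ μ q m vm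
    intercept-first-edge 1≤r {m} {vm} ((1≤m , m≤r , Aₘ) , μ≤μₘ , _) =
      trans (cong intercept edge₀≡chord) (≤-antisym a₁≤μₘ μₘ≤a₁)
      where
      C₁ = chord q (d 1) (e 1)
      Cₘ = chord q m vm
      0<s = s>0 1≤r
      1≤d₁ = 1≤d[1+j] 0<s
      d₁≤r : d 1 ℕ.≤ r
      d₁≤r = subst (d 1 ℕ.≤_) end (stepwise-<⇒mono-≤ d incr 0<s ℕ.≤-refl)
      a₁≤μₘ : intercept C₁ ≤ μ q m vm
      a₁≤μₘ = subst (_≤ μ q m vm) (μ≡intercept-chord 1<q (e 1) 1≤d₁)
                    (μ≤μₘ (d 1) (e 1) 1≤d₁ d₁≤r (isPoint 1 0<s))
      cross : C₁ ⟨ 1ℚ ⟩ ≡ Cₘ ⟨ 1ℚ ⟩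
      cross = trans (chord-⟨1⟩ 1<q (d 1) (e 1)) (sym (chord-⟨1⟩ 1<q m vm))
      below-at-qᵐ : C₁ ⟨ qpow q m ⟩ ≤ Cₘ ⟨ qpow q m ⟩
      below-at-qᵐ = subst₂ _≤_ (cong (_⟨ qpow q m ⟩) edge₀≡chord) (sym (chord-⟨qⁿ⟩ 1<q vm 1≤m))
                           (edge-⟨⟩≤ 0<s m≤r Aₘ)
      μₘ≤a₁ : μ q m vm ≤ intercept C₁
      μₘ≤a₁ = subst₂ _≤_ (trans (⟨0⟩≡intercept Cₘ) (sym (μ≡intercept-chord 1<q vm 1≤m)))
                         (⟨0⟩≡intercept C₁)
        (gradient-≤⇒≥-left cross (<⇒≤ (qpow-positive 1<q 0))
          (≤-right⇒gradient-≤ cross (1<qpow 1<q 1≤m) below-at-qᵐ))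

lemma3p3 : (q : ℕ) → IsPrimePower q → (r : ℕ) → 1 ℕ.≤ r →
           (degA : ℕ → Maybe ℚ) → degA 0 ≡ just 1ℚ → ∃[ v ] degA r ≡ just v →
           (s : ℕ) (d : ℕ → ℕ) (e : ℕ → ℚ) → NewtonVertices q r degA s d e →
           (m : ℕ) (vm : ℚ) → IsM q r degA m vm →
           (edgeIntercept q d e 1 ≡ μ q m vm)
           × (∀ j → 1 ℕ.≤ j → j ℕ.< s → edgeIntercept q d e j > edgeIntercept q d e (suc j))
           × (∀ j → 1 ℕ.≤ j → j ℕ.≤ s → - edgeIntercept q d e j ≥ - μ q (d j) (e j))
lemma3p3 q q-primePower r 1≤r degA A₀ _ s d e nv m vm isM =
  intercept-first-edge A₀ 1≤r isM , decreasing , bounded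
  where
  open NewtonPolygon (primePower>1 q-primePower) nv

  decreasing : ∀ j → 1 ℕ.≤ j → j ℕ.< s → edgeIntercept q d e j > edgeIntercept q d e (suc j)
  decreasing (suc j) _ 1+j<s = intercept-edge-decreasing 1+j<s

  bounded : ∀ j → 1 ℕ.≤ j → j ℕ.≤ s → - edgeIntercept q d e j ≥ - μ q (d j) (e j)
  bounded (suc j) _ j<s = neg-antimono-≤ (intercept-edge≤μ A₀ j<s)
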